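{- Let $L,a,b,c,r$ be positive integers with $b\mid r$, such that $r=x_1a+x_2c$ for some integers $x_1,x_2\ge 0$ and $Lc=y_1a+y_2b$ for some integers $y_1,y_2\ge 0$. Then the squares $(r+ac\times r+ac)$ and $(Lc+kab\times Lc+kab)$ can be tiled with $(a\times a)$, $(b\times b)$ and $(c\times c)$ squares, for any integer $k\ge 1$.
   Context: $(m\times m)$ denotes the square $[0,m]\times[0,m]\subseteq\mathbb{R}^2$. A square is tiled with bricks $B_1,\dots,B_k$ if it is the union of finitely many translated copies of the $B_i$ with pairwise disjoint interiors. -}

module Defs where

open import Data.Nat using (ℕ; zero; suc; _+_; _*_; _≤_; _<_; _≤ᵇ_; _<ᵇ_)
open import Data.Bool using (Bool; true; false; _∧_; if_then_else_)
open import Data.List using (List; []; _∷_)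
open import Data.List.Relation.Unary.All using (All)
open import Data.Product using (Σ; ∃; _×_)
open import Data.Sum using (_⊎_)
open import Relation.Binary.PropositionalEquality using (_≡_)

-- A placed square tile: lower-left corner (x , y) and side length s,
-- occupying [x, x+s] × [y, y+s].
record Tile : Set where
  constructor tile
  field
    x : ℕ
    y : ℕ
    s : ℕ

open Tile public

covers : Tile → ℕ → ℕ → Bool
covers t i j = (x t ≤ᵇ i) ∧ (i <ᵇ x t + s t) ∧ (y t ≤ᵇ j) ∧ (j <ᵇ y t + s t)

multiplicity : List Tile → ℕ → ℕ → ℕ
multiplicity [] i j = 0
multiplicity (t ∷ ts) i j = (if covers t i j then 1 else 0) + multiplicity ts i j

Admissible : ℕ → ℕ → ℕ → ℕ → Tile → Set
Admissible m a b c t =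
  (s t ≡ a ⊎ s t ≡ b ⊎ s t ≡ c) × (x t + s t ≤ m) × (y t + s t ≤ m)

-- ts is a tiling of the square (m × m) by (a × a), (b × b), (c × c) squares:
-- every tile is an admissible translate, and every unit cell of the square
-- is covered by exactly one tile (so the tiles cover the square and have
-- pairwise disjoint interiors).
IsTiling : ℕ → ℕ → ℕ → ℕ → List Tile → Set
IsTiling m a b c ts =
  All (Admissible m a b c) ts ×
  (∀ i j → i < m → j < m → multiplicity ts i j ≡ 1)

Tileable : ℕ → ℕ → ℕ → ℕ → Set
Tileable m a b c = ∃ λ (ts : List Tile) → IsTiling m a b c ts

-- Take u = r, v = ac (resp. u = Lc, v = kab) and cut the square of side
-- u + v into the squares [0,u]², [u,u+v]² and two u × v rectangles.  The
-- squares are grids of b- and a-tiles (resp. c- and a-tiles).  Each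
-- rectangle splits along its side u = x₁a + x₂c (resp. y₁a + y₂b) into two
-- strips, which are grids because a and c divide ac (resp. a and b divide
-- kab).
module Submission where

open import Defs
open import Data.Nat using (ℕ; _+_; _*_; _≤_; _<_; _≤ᵇ_; _<ᵇ_; zero; suc; z≤n)
open import Data.Nat.Properties
open import Data.Nat.Divisibility using (_∣_; divides; n∣m*n; m∣m*n; n∣m*n*o)
open import Data.Product using (∃₂; _×_; _,_)
open import Data.Sum using (_⊎_; inj₁; inj₂)
open import Data.Bool using (true; false; _∧_; if_then_else_; T)
open import Data.Bool.Properties using (∧-assoc; ∧-zeroʳ)
open import Data.Unit using (tt)
open import Data.Empty using (⊥-elim)
open import Data.List using (List; []; _∷_; _++_; map)
open import Data.List.Relation.Unary.All using (All; []; _∷_)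
open import Data.List.Relation.Unary.All.Properties using (++⁺; map⁺)
import Data.List.Relation.Unary.All as All
open import Relation.Nullary using (¬_; yes; no)
open import Relation.Binary.PropositionalEquality
open ≡-Reasoning

T⇒≡true : ∀ {b} → T b → b ≡ true
T⇒≡true {true} _ = refl

¬T⇒≡false : ∀ {b} → ¬ T b → b ≡ false
¬T⇒≡false {true}  ¬t = ⊥-elim (¬t tt)
¬T⇒≡false {false} _  = refl

if-∧ : ∀ p q → (if p ∧ q then 1 else 0) ≡ (if p then 1 else 0) * (if q then 1 else 0)
if-∧ true  q = sym (+-identityʳ _)
if-∧ false q = refl

indicator : ℕ → ℕ → ℕ → ℕ
indicator x w i = if (x ≤ᵇ i) ∧ (i <ᵇ x + w) then 1 else 0

module _ (x w : ℕ) {i : ℕ} where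

  indicator-inside : x ≤ i → i < x + w → indicator x w i ≡ 1
  indicator-inside x≤i i<x+w
    rewrite T⇒≡true (≤⇒≤ᵇ x≤i) | T⇒≡true (<⇒<ᵇ i<x+w) = refl

  indicator-before : i < x → indicator x w i ≡ 0
  indicator-before i<x
    rewrite ¬T⇒≡false {x ≤ᵇ i} (λ t → <⇒≱ i<x (≤ᵇ⇒≤ x i t)) = refl

  indicator-after : x + w ≤ i → indicator x w i ≡ 0
  indicator-after x+w≤i
    rewrite ¬T⇒≡false {i <ᵇ x + w} (λ t → ≤⇒≯ x+w≤i (<ᵇ⇒< i (x + w) t))
          | ∧-zeroʳ (x ≤ᵇ i) = refl

indicator-zero : ∀ x i → indicator x 0 i ≡ 0
indicator-zero x i with i <? x
... | yes i<x = indicator-before x 0 i<x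
... | no  i≮x = indicator-after x 0 (subst (_≤ i) (sym (+-identityʳ x)) (≮⇒≥ i≮x))

indicator-+ : ∀ x w₁ w₂ i →
  indicator x w₁ i + indicator (x + w₁) w₂ i ≡ indicator x (w₁ + w₂) i
indicator-+ x w₁ w₂ i with i <? x
... | yes i<x = trans
  (cong₂ _+_ (indicator-before x w₁ i<x)
             (indicator-before (x + w₁) w₂ (<-≤-trans i<x (m≤m+n x w₁))))
  (sym (indicator-before x (w₁ + w₂) i<x))
... | no i≮x with i <? x + w₁
...   | yes i<x+w₁ = trans
  (cong₂ _+_ (indicator-inside x w₁ (≮⇒≥ i≮x) i<x+w₁)
             (indicator-before (x + w₁) w₂ i<x+w₁))
  (sym (indicator-inside x (w₁ + w₂) (≮⇒≥ i≮x)
         (<-≤-trans i<x+w₁ (+-monoʳ-≤ x (m≤m+n w₁ w₂)))))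
...   | no i≮x+w₁ with i <? x + w₁ + w₂
...     | yes i<end = trans
  (cong₂ _+_ (indicator-after x w₁ (≮⇒≥ i≮x+w₁))
             (indicator-inside (x + w₁) w₂ (≮⇒≥ i≮x+w₁) i<end))
  (sym (indicator-inside x (w₁ + w₂) (≮⇒≥ i≮x) (subst (i <_) (+-assoc x w₁ w₂) i<end)))
...     | no i≮end = trans
  (cong₂ _+_ (indicator-after x w₁ (≮⇒≥ i≮x+w₁))
             (indicator-after (x + w₁) w₂ (≮⇒≥ i≮end)))
  (sym (indicator-after x (w₁ + w₂) (subst (_≤ i) (+-assoc x w₁ w₂) (≮⇒≥ i≮end))))

covers-indicator : ∀ t i j →
  (if covers t i j then 1 else 0) ≡ indicator (x t) (s t) i * indicator (y t) (s t) j
covers-indicator (tile x y s) i j = begin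
  (if x≤i ∧ (i<end ∧ rest) then 1 else 0)   ≡⟨ cong (if_then 1 else 0) (sym (∧-assoc x≤i i<end rest)) ⟩
  (if (x≤i ∧ i<end) ∧ rest then 1 else 0)   ≡⟨ if-∧ (x≤i ∧ i<end) rest ⟩
  indicator x s i * indicator y s j         ∎
  where
  x≤i = x ≤ᵇ i
  i<end = i <ᵇ x + s
  rest = (y ≤ᵇ j) ∧ (j <ᵇ y + s)

multiplicity-++ : ∀ ts us i j →
  multiplicity (ts ++ us) i j ≡ multiplicity ts i j + multiplicity us i j
multiplicity-++ []       us i j = refl
multiplicity-++ (t ∷ ts) us i j rewrite multiplicity-++ ts us i j =
  sym (+-assoc (if covers t i j then 1 else 0) _ _)

transposeTile : Tile → Tile
transposeTile (tile x y s) = tile y x s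

multiplicity-transpose : ∀ ts i j → multiplicity (map transposeTile ts) i j ≡ multiplicity ts j i
multiplicity-transpose []       i j = refl
multiplicity-transpose (t@(tile x y s) ∷ ts) i j =
  cong₂ _+_ covers-transpose (multiplicity-transpose ts i j)
  where
  covers-transpose : (if covers (tile y x s) i j then 1 else 0) ≡ (if covers t j i then 1 else 0)
  covers-transpose = begin
    (if covers (tile y x s) i j then 1 else 0)   ≡⟨ covers-indicator (tile y x s) i j ⟩
    indicator y s i * indicator x s j            ≡⟨ *-comm (indicator y s i) _ ⟩
    indicator x s j * indicator y s i            ≡⟨ covers-indicator t j i ⟨
    (if covers t j i then 1 else 0)              ∎

Side : ℕ → ℕ → ℕ → ℕ → Set
Side a b c s = s ≡ a ⊎ s ≡ b ⊎ s ≡ c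

prefix-fits : ∀ x u {v m} → x + (u + v) ≤ m → x + u ≤ m
prefix-fits x u {v} = ≤-trans (+-monoʳ-≤ x (m≤m+n u v))

suffix-fits : ∀ x u {v m} → x + (u + v) ≤ m → x + u + v ≤ m
suffix-fits x u {v} {m} = subst (_≤ m) (sym (+-assoc x u v))

record RectangleTiling (m a b c x y w h : ℕ) : Set where
  constructor rectangleTiling
  field
    tiles : List Tile
    admissible : All (Admissible m a b c) tiles
    multiplicity-tiles : ∀ i j → multiplicity tiles i j ≡ indicator x w i * indicator y h j

module _ {m a b c : ℕ} where

  admissible-transpose : ∀ {t} → Admissible m a b c t → Admissible m a b c (transposeTile t)
  admissible-transpose {tile _ _ _} (side , fits-x , fits-y) = side , fits-y , fits-x

  transpose : ∀ {x y w h} → RectangleTiling m a b c x y w h → RectangleTiling m a b c y x h w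
  transpose {x} {y} {w} {h} (rectangleTiling ts adm mult) = rectangleTiling
    (map transposeTile ts)
    (map⁺ (All.map admissible-transpose adm))
    λ i j → begin
      multiplicity (map transposeTile ts) i j   ≡⟨ multiplicity-transpose ts i j ⟩
      multiplicity ts j i                       ≡⟨ mult j i ⟩
      indicator x w j * indicator y h i         ≡⟨ *-comm (indicator x w j) _ ⟩
      indicator y h i * indicator x w j         ∎

  beside : ∀ {x y w₁ w₂ h} →
    RectangleTiling m a b c x y w₁ h → RectangleTiling m a b c (x + w₁) y w₂ h →
    RectangleTiling m a b c x y (w₁ + w₂) h
  beside {x} {y} {w₁} {w₂} {h} (rectangleTiling ts adm₁ mult₁) (rectangleTiling us adm₂ mult₂) =
    rectangleTiling (ts ++ us) (++⁺ adm₁ adm₂) λ i j → begin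
      multiplicity (ts ++ us) i j
        ≡⟨ multiplicity-++ ts us i j ⟩
      multiplicity ts i j + multiplicity us i j
        ≡⟨ cong₂ _+_ (mult₁ i j) (mult₂ i j) ⟩
      indicator x w₁ i * indicator y h j + indicator (x + w₁) w₂ i * indicator y h j
        ≡⟨ *-distribʳ-+ (indicator y h j) (indicator x w₁ i) _ ⟨
      (indicator x w₁ i + indicator (x + w₁) w₂ i) * indicator y h j
        ≡⟨ cong (_* indicator y h j) (indicator-+ x w₁ w₂ i) ⟩
      indicator x (w₁ + w₂) i * indicator y h j
        ∎

  above : ∀ {x y w h₁ h₂} →
    RectangleTiling m a b c x y w h₁ → RectangleTiling m a b c x (y + h₁) w h₂ →
    RectangleTiling m a b c x y w (h₁ + h₂)
  above lower upper = transpose (beside (transpose lower) (transpose upper))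

  emptyRectangle : ∀ {x y h} → RectangleTiling m a b c x y 0 h
  emptyRectangle {x} {y} {h} = rectangleTiling [] [] λ i j →
    sym (cong (_* indicator y h j) (indicator-zero x i))

  square : ∀ {x y s} → Side a b c s → x + s ≤ m → y + s ≤ m → RectangleTiling m a b c x y s s
  square {x} {y} {s} side fits-x fits-y = rectangleTiling
    (tile x y s ∷ [])
    ((side , fits-x , fits-y) ∷ [])
    λ i j → trans (+-identityʳ _) (covers-indicator (tile x y s) i j)

  repeatRight : ∀ {y w h} → (∀ x → x + w ≤ m → RectangleTiling m a b c x y w h) →
    ∀ p x → x + p * w ≤ m → RectangleTiling m a b c x y (p * w) h
  repeatRight tiling zero    x _    = emptyRectangle
  repeatRight {w = w} tiling (suc p) x fits =
    beside (tiling x (prefix-fits x w fits)) (repeatRight tiling p (x + w) (suffix-fits x w fits))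

  repeatUp : ∀ {x w h} → (∀ y → y + h ≤ m → RectangleTiling m a b c x y w h) →
    ∀ q y → y + q * h ≤ m → RectangleTiling m a b c x y w (q * h)
  repeatUp tiling q y fits =
    transpose (repeatRight (λ y' fits' → transpose (tiling y' fits')) q y fits)

  grid : ∀ {x y s} p q → Side a b c s → x + p * s ≤ m → y + q * s ≤ m →
    RectangleTiling m a b c x y (p * s) (q * s)
  grid {x} p q side fits-x fits-y =
    repeatUp (λ y' fits-y' → repeatRight (λ x' fits-x' → square side fits-x' fits-y') p x fits-x)
             q _ fits-y

  divisibleRectangle : ∀ {x y w h s} → Side a b c s → s ∣ w → s ∣ h → x + w ≤ m → y + h ≤ m →
    RectangleTiling m a b c x y w h
  divisibleRectangle side (divides p refl) (divides q refl) = grid p q side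

  twoStripRectangle : ∀ {x y w h s₁ s₂} → Side a b c s₁ → Side a b c s₂ → s₁ ∣ h → s₂ ∣ h →
    (∃₂ λ p₁ p₂ → w ≡ p₁ * s₁ + p₂ * s₂) → x + w ≤ m → y + h ≤ m →
    RectangleTiling m a b c x y w h
  twoStripRectangle {x} {s₁ = s₁} side₁ side₂ s₁∣h s₂∣h (p₁ , p₂ , refl) fits-x fits-y = beside
    (divisibleRectangle side₁ (n∣m*n p₁) s₁∣h (prefix-fits x (p₁ * s₁) fits-x) fits-y)
    (divisibleRectangle side₂ (n∣m*n p₂) s₂∣h (suffix-fits x (p₁ * s₁) fits-x) fits-y)

  tileable : RectangleTiling m a b c 0 0 m m → Tileable m a b c
  tileable (rectangleTiling ts adm mult) = ts , adm , λ i j i<m j<m →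
    trans (mult i j) (cong₂ _*_ (indicator-inside 0 m z≤n i<m) (indicator-inside 0 m z≤n j<m))

tileable-+ : ∀ {a b c u v t t′ s₁ s₂} →
  Side a b c t → t ∣ u → Side a b c t′ → t′ ∣ v →
  Side a b c s₁ → Side a b c s₂ → s₁ ∣ v → s₂ ∣ v →
  (∃₂ λ p₁ p₂ → u ≡ p₁ * s₁ + p₂ * s₂) →
  Tileable (u + v) a b c
tileable-+ {a} {b} {c} {u} {v} side t∣u side′ t′∣v side₁ side₂ s₁∣v s₂∣v u-combination =
  tileable (beside (above lowerSquare strip) (above (transpose strip) upperSquare))
  where
  lowerSquare : RectangleTiling (u + v) a b c 0 0 u u
  lowerSquare = divisibleRectangle side t∣u t∣u (m≤m+n u v) (m≤m+n u v)
  upperSquare : RectangleTiling (u + v) a b c u u v v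
  upperSquare = divisibleRectangle side′ t′∣v t′∣v ≤-refl ≤-refl
  strip : RectangleTiling (u + v) a b c 0 u u v
  strip = twoStripRectangle side₁ side₂ s₁∣v s₂∣v u-combination (m≤m+n u v) ≤-refl

proposition2p4 : (L a b c r : ℕ) → 0 < L → 0 < a → 0 < b → 0 < c → 0 < r →
    b ∣ r →
    (∃₂ λ (x₁ x₂ : ℕ) → r ≡ x₁ * a + x₂ * c) →
    (∃₂ λ (y₁ y₂ : ℕ) → L * c ≡ y₁ * a + y₂ * b) →
    Tileable (r + a * c) a b c ×
      ((k : ℕ) → 1 ≤ k → Tileable (L * c + k * a * b) a b c)
proposition2p4 L a b c r _ _ _ _ _ b∣r r-combination Lc-combination =
  tileable-+ side-b b∣r side-a (m∣m*n c) side-a side-c (m∣m*n c) (n∣m*n a) r-combination ,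
  λ k _ → tileable-+ side-c (n∣m*n L) side-a (n∣m*n*o k b)
                     side-a side-b (n∣m*n*o k b) (n∣m*n (k * a)) Lc-combination
  where
  side-a : Side a b c a
  side-a = inj₁ refl
  side-b : Side a b c b
  side-b = inj₂ (inj₁ refl)
  side-c : Side a b c c
  side-c = inj₂ (inj₂ refl)
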